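{- Let $\mathcal{G}=(G,A,B)$ be a bipartite graph and let $X\subseteq V(G)$. If $\mathcal{G}'=(G',A',B')$ is a bipartite graph obtained from $\mathcal{G}$ by successively pivoting on edges with neither end in $X$, then $\mathcal{G}'[X]$ is a $\rho_G(X)$-pivot-perturbation of $\mathcal{G}[X]$.
   Context: A bipartite graph is a tuple $(G,A,B)$ with $G$ a finite simple graph and $A,B$ disjoint with $A\cup B=V(G)$, every edge having one end in $A$ and one in $B$. For a vertex $v$, $G*v$ replaces the induced subgraph on $N_G(v)$ by its complement, and for an edge $uv$, $G\times uv=G*u*v*u$. Pivoting a bipartite graph on edge $uv$ with $u\in A$ gives $(G\times uv,(A\setminus\{u\})\cup\{v\},(B\setminus\{v\})\cup\{u\})$. For $X\subseteq V(G)$, $\mathcal{G}[X]=(G[X],A\cap X,B\cap X)$. A pivot-minor of $\mathcal{G}$ is $\mathcal{G}''[Y]$ for some $\mathcal{G}''$ obtained from $\mathcal{G}$ by pivots and some $Y$. A bipartite graph $\mathcal{G}_1$ is a $t$-pivot-perturbation of a bipartite graph $\mathcal{G}_2$ with the same vertex set if some bipartite graph with at most $t$ more vertices contains both $\mathcal{G}_1$ and $\mathcal{G}_2$ as pivot-minors. The cut-rank $\rho_G(X)$ is the $\mathrm{GF}(2)$-rank of the submatrix of the adjacency matrix of $G$ with rows $X$ and columns $V(G)\setminus X$. -}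

module Defs where

open import Data.Nat using (ℕ; _+_; _≤_)
open import Data.Fin using (Fin; _≟_)
open import Data.Bool using (Bool; true; false; not; _∧_; _xor_; if_then_else_)
open import Data.Product using (Σ; _×_; ∃)
open import Data.Unit using (⊤)
open import Relation.Nullary using (¬_)
open import Relation.Nullary.Decidable using (⌊_⌋)
open import Relation.Binary.PropositionalEquality using (_≡_; _≢_)
open import Function.Definitions using (Injective)

-- A (raw) graph on vertex set Fin n together with a 2-colouring:
-- side x ≡ true  means x ∈ A,  side x ≡ false  means x ∈ B.
record Graph (n : ℕ) : Set where
  constructor mkGraph
  field
    adj  : Fin n → Fin n → Bool
    side : Fin n → Bool
open Graph public

record IsBipartite {n : ℕ} (G : Graph n) : Set where
  field
    symm    : ∀ x y → adj G x y ≡ adj G y x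
    irrefl  : ∀ x → adj G x x ≡ false
    crosses : ∀ x y → adj G x y ≡ true → side G x ≢ side G y

localComp : ∀ {n} → Graph n → Fin n → Graph n
localComp G v = mkGraph adj' (side G)
  where
  adj' : _ → _ → Bool
  adj' x y = if not ⌊ x ≟ y ⌋ ∧ adj G v x ∧ adj G v y
               then not (adj G x y) else adj G x y

-- G × uv = G * u * v * u, and the ends u, v exchange sides
-- (for u ∈ A, v ∈ B this is exactly (G×uv, (A∖{u})∪{v}, (B∖{v})∪{u})).
pivot : ∀ {n} → Graph n → Fin n → Fin n → Graph n
pivot G u v = mkGraph (adj H) side'
  where
  H : Graph _
  H = localComp (localComp (localComp G u) v) u
  side' : _ → Bool
  side' x = if ⌊ x ≟ u ⌋ then side G v
            else (if ⌊ x ≟ v ⌋ then side G u else side G x)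

data Pivots {n : ℕ} (P : Fin n → Set) : Graph n → Graph n → Set where
  done : ∀ {G} → Pivots P G G
  step : ∀ {G G'} (u v : Fin n) → P u → P v → adj G u v ≡ true →
         Pivots P (pivot G u v) G' → Pivots P G G'

-- G[X] where X is the image of an (injective) map ι : Fin m → Fin n;
-- vertex i of the result is the vertex ι i of G.
restrict : ∀ {n m} → Graph n → (Fin m → Fin n) → Graph m
restrict G ι = mkGraph (λ i j → adj G (ι i) (ι j)) (λ i → side G (ι i))

_≐_ : ∀ {m} → Graph m → Graph m → Set
G₁ ≐ G₂ = (∀ i j → adj G₁ i j ≡ adj G₂ i j) × (∀ i → side G₁ i ≡ side G₂ i)

-- G₁ is a pivot-minor of H, the vertices of G₁ being identified with
-- vertices of H via the injection e:  G₁ = H''[e(V(G₁))] for some H''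
-- obtained from H by pivots.
PivotMinorVia : ∀ {m n} → Graph n → (Fin m → Fin n) → Graph m → Set
PivotMinorVia H e G₁ = Σ (Graph _) λ H'' → Pivots (λ _ → ⊤) H H'' × (restrict H'' e ≐ G₁)

PivotPerturbation : ∀ {m} → ℕ → Graph m → Graph m → Set
PivotPerturbation {m} t G₁ G₂ =
  Σ ℕ λ k → k ≤ t × Σ (Graph (m + k)) λ H → IsBipartite H ×
    Σ (Fin m → Fin (m + k)) λ e → Injective _≡_ _≡_ e ×
      PivotMinorVia H e G₁ × PivotMinorVia H e G₂

-- Linear algebra over GF(2) (Bool with xor as addition, ∧ as multiplication).
sumF : ∀ {k} → (Fin k → Bool) → Bool
sumF {ℕ.zero}  f = false
sumF {ℕ.suc k} f = f Fin.zero xor sumF (λ i → f (Fin.suc i))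

LinIndep : ∀ {k c} → (Fin k → Fin c → Bool) → Set
LinIndep {k} v = ∀ (s : Fin k → Bool) →
  (∀ j → sumF (λ i → s i ∧ v i j) ≡ false) → ∀ i → s i ≡ false

HasRank : ∀ {a c} → (Fin a → Fin c → Bool) → ℕ → Set
HasRank {a} M r =
  (Σ (Fin r → Fin a) λ f → Injective _≡_ _≡_ f × LinIndep (λ i → M (f i))) ×
  (∀ k (g : Fin k → Fin a) → Injective _≡_ _≡_ g → LinIndep (λ i → M (g i)) → k ≤ r)

-- cut-rank ρ_G(X) = r : rank of the submatrix of the adjacency matrix with rows X
-- and columns V(G)∖X.  Rows are indexed by an enumeration xs of X; columns in X are
-- set to 0, which does not change the rank of the submatrix.
CutRank : ∀ {n m} → Graph n → (X : Fin n → Bool) → (xs : Fin m → Fin n) → ℕ → Set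
CutRank G X xs r = HasRank (λ i y → adj G (xs i) y ∧ not (X y)) r

-- Fix a row basis (indexed by Fin r) of the cut matrix of X and write every row x as a
-- combination c x of basis rows on the side of x.  Pivoting on an edge outside X keeps the
-- rows combining in this way, and changes G[X] by a bilinear form in these coefficients:
-- G'[x,x'] ⊕ G[x,x'] = Σᵢⱼ c x i · c x' j · D i j, where D is the change on the basis vertices.
-- D only joins basis vertices on opposite sides, so taking the side β with fewer basis
-- vertices (at most r/2 of them), the same form is produced by attaching to G[X] one new edge
-- aₖbₖ per basis vertex k on side β, with aₖ joined to the x with c x k and bₖ to the x with
-- Σⱼ c x j · D k j, and pivoting on all these edges.  The resulting graph on at most r extra
-- vertices has both G[X] and G'[X] as pivot-minors.

module Submission where

open import Defs
open import Data.Nat using (ℕ; zero; suc; _+_; _≤_; _<_; _≤?_; _<?_; s≤s; s≤s⁻¹)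
open import Data.Nat.Properties
  using (+-suc; +-comm; +-identityʳ; ≤-trans; ≤-reflexive; +-monoʳ-≤; ≰⇒>; <⇒≤; 1+n≰n; <-cmp; <-irrefl;
         m<n⇒m<1+n; ≤-refl; <⇒≱; m≤n+m)
open import Data.Fin using (Fin; _≟_; toℕ; fromℕ<; splitAt; join) renaming (zero to fz; suc to fs)
open import Data.Fin.Properties using (all?; toℕ<n; toℕ-fromℕ<; toℕ-injective; splitAt-join; join-splitAt)
open import Data.Bool using (Bool; true; false; not; _∧_; _xor_; if_then_else_)
open import Data.Bool.Properties
  using (xor-comm; xor-assoc; xor-same; xor-identityʳ; ∧-comm; ∧-assoc; ∧-zeroʳ; ∧-identityʳ;
         ∧-distribˡ-xor; ∧-distribʳ-xor; ¬-not; not-¬; not-involutive; not-distribˡ-xor; xor-∧-commutativeRing)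
  renaming (_≟_ to _≟ᵇ_)
open import Data.Fin.Subset.Properties using (anySubset?)
open import Data.Vec using (lookup; tabulate)
open import Data.Vec.Properties using (lookup∘tabulate)
open import Algebra.Bundles using (CommutativeRing)
open import Algebra.Properties.CommutativeSemigroup (CommutativeRing.+-commutativeSemigroup xor-∧-commutativeRing)
  using () renaming (interchange to xor-interchange; xy∙z≈xz∙y to xor-rightComm)
open import Data.Product using (Σ; _×_; ∃; _,_; proj₁; proj₂)
open import Data.Sum using (inj₁; inj₂)
open import Data.Unit using (⊤; tt)
open import Data.Empty using (⊥-elim)
open import Relation.Nullary using (¬_; yes; no; Dec)
open import Relation.Nullary.Decidable using (⌊_⌋; isYes≗does; dec-true; dec-false)
open import Relation.Binary.Definitions using (tri<; tri≈; tri>)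
open import Relation.Binary.PropositionalEquality
open import Function.Definitions using (Injective)
open import Function.Base using (_∘_)
open ≡-Reasoning

⌊⌋-yes : ∀ {A : Set} (a? : Dec A) → A → ⌊ a? ⌋ ≡ true
⌊⌋-yes a? a = trans (isYes≗does a?) (dec-true a? a)

⌊⌋-no : ∀ {A : Set} (a? : Dec A) → ¬ A → ⌊ a? ⌋ ≡ false
⌊⌋-no a? ¬a = trans (isYes≗does a?) (dec-false a? ¬a)

⌊≟⌋-refl : ∀ {n} (i : Fin n) → ⌊ i ≟ i ⌋ ≡ true
⌊≟⌋-refl i = ⌊⌋-yes (i ≟ i) refl

⌊≟⌋-≢ : ∀ {n} {i j : Fin n} → i ≢ j → ⌊ i ≟ j ⌋ ≡ false
⌊≟⌋-≢ {i = i} {j} = ⌊⌋-no (i ≟ j)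

true≢false : true ≢ false
true≢false ()

xor-false⇒≡ : ∀ {a b} → a xor b ≡ false → a ≡ b
xor-false⇒≡ {false} {false} _ = refl
xor-false⇒≡ {true}  {true}  _ = refl

xor-solveˡ : ∀ {a g t} → a xor g ≡ t → a ≡ g xor t
xor-solveˡ {a} {g} refl = begin
  a                   ≡⟨ sym (cong (_xor a) (xor-same g)) ⟩
  (g xor g) xor a     ≡⟨ xor-rightComm g g a ⟩
  (g xor a) xor g     ≡⟨ xor-assoc g a g ⟩
  g xor (a xor g)     ∎

∧-true⇒× : ∀ {a b} → a ∧ b ≡ true → a ≡ true × b ≡ true
∧-true⇒× {true} {true} _ = refl , refl

∧-false : ∀ {a b} → (a ≡ true → b ≡ false) → a ∧ b ≡ false
∧-false {true}  h = h refl
∧-false {false} h = refl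

if-as-xor : ∀ c a → (if c then not a else a) ≡ c xor a
if-as-xor true  a = refl
if-as-xor false a = refl

-- Sums over GF(2)

sumF-cong : ∀ {k} {f g : Fin k → Bool} → (∀ i → f i ≡ g i) → sumF f ≡ sumF g
sumF-cong {zero}  e = refl
sumF-cong {suc k} e = cong₂ _xor_ (e fz) (sumF-cong (λ i → e (fs i)))

sumF-zero : ∀ {k} {f : Fin k → Bool} → (∀ i → f i ≡ false) → sumF f ≡ false
sumF-zero {zero}  e = refl
sumF-zero {suc k} e = cong₂ _xor_ (e fz) (sumF-zero (λ i → e (fs i)))

sumF-xor : ∀ {k} (f g : Fin k → Bool) → sumF (λ i → f i xor g i) ≡ sumF f xor sumF g
sumF-xor {zero}  f g = refl
sumF-xor {suc k} f g =
  trans (cong ((f fz xor g fz) xor_) (sumF-xor (λ i → f (fs i)) (λ i → g (fs i))))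
        (xor-interchange (f fz) (g fz) _ _)

∧-distribˡ-sumF : ∀ {k} a (f : Fin k → Bool) → a ∧ sumF f ≡ sumF (λ i → a ∧ f i)
∧-distribˡ-sumF {zero}  a f = ∧-zeroʳ a
∧-distribˡ-sumF {suc k} a f =
  trans (∧-distribˡ-xor a (f fz) _) (cong ((a ∧ f fz) xor_) (∧-distribˡ-sumF a (λ i → f (fs i))))

∧-distribʳ-sumF : ∀ {k} a (f : Fin k → Bool) → sumF f ∧ a ≡ sumF (λ i → f i ∧ a)
∧-distribʳ-sumF a f = trans (∧-comm _ a) (trans (∧-distribˡ-sumF a f) (sumF-cong (λ i → ∧-comm a (f i))))

sumF-comm : ∀ {k l} (h : Fin k → Fin l → Bool) →
  sumF (λ i → sumF (λ j → h i j)) ≡ sumF (λ j → sumF (λ i → h i j))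
sumF-comm {zero} {l} h = sym (sumF-zero {l} (λ _ → refl))
sumF-comm {suc k} h =
  trans (cong (sumF (h fz) xor_) (sumF-comm (λ i j → h (fs i) j)))
        (sym (sumF-xor (λ j → h fz j) (λ j → sumF (λ i → h (fs i) j))))

sumF-indicator : ∀ {k} (g : Fin k → Bool) (j : Fin k) → sumF (λ i → ⌊ i ≟ j ⌋ ∧ g i) ≡ g j
sumF-indicator {suc k} g fz =
  trans (cong₂ _xor_ (cong (_∧ g fz) (⌊≟⌋-refl (fz {k})))
                     (sumF-zero (λ i → cong (_∧ g (fs i)) (⌊≟⌋-≢ {i = fs i} {fz} λ ()))))
        (xor-identityʳ (g fz))
sumF-indicator {suc k} g (fs j) =
  trans (cong₂ _xor_ (cong (_∧ g fz) (⌊≟⌋-≢ {i = fz} {fs j} λ ()))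
                     (sumF-cong (λ i → cong (_∧ g (fs i)) (fs-≟ i))))
        (sumF-indicator (λ i → g (fs i)) j)
  where
  fs-≟ : ∀ i → ⌊ fs i ≟ fs j ⌋ ≡ ⌊ i ≟ j ⌋
  fs-≟ i with i ≟ j
  ... | yes _ = refl
  ... | no  _ = refl

sumF-true⇒∃ : ∀ {k} (f : Fin k → Bool) → sumF f ≡ true → ∃ λ i → f i ≡ true
sumF-true⇒∃ {suc k} f e with f fz in eq
... | true  = fz , eq
... | false with sumF-true⇒∃ (λ i → f (fs i)) e
...   | i , p = fs i , p

sumF-bilinear : ∀ {k l} (p s : Fin k → Bool) (q t : Fin l → Bool) →
  sumF (λ i → p i ∧ s i) ∧ sumF (λ j → q j ∧ t j) ≡
  sumF (λ i → sumF (λ j → (p i ∧ q j) ∧ (s i ∧ t j)))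
sumF-bilinear p s q t =
  trans (∧-distribʳ-sumF _ (λ i → p i ∧ s i))
        (sumF-cong (λ i → trans (∧-distribˡ-sumF (p i ∧ s i) (λ j → q j ∧ t j))
                                (sumF-cong (λ j → ∧-interchange (p i) (s i) (q j) (t j)))))
  where
  ∧-interchange : ∀ a b c d → (a ∧ b) ∧ (c ∧ d) ≡ (a ∧ c) ∧ (b ∧ d)
  ∧-interchange true  b true  d = refl
  ∧-interchange true  b false d = ∧-zeroʳ b
  ∧-interchange false b c     d = refl

infix 7 _·_

_·_ : ∀ {k} → (Fin k → Bool) → (Fin k → Bool) → Bool
s · g = sumF (λ i → s i ∧ g i)

·-cong : ∀ {k} (s : Fin k → Bool) {g h : Fin k → Bool} → (∀ i → g i ≡ h i) → s · g ≡ s · h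
·-cong s e = sumF-cong (λ i → cong (s i ∧_) (e i))

·-xor : ∀ {k} (s g h : Fin k → Bool) → s · (λ i → g i xor h i) ≡ s · g xor s · h
·-xor s g h = trans (sumF-cong (λ i → ∧-distribˡ-xor (s i) (g i) (h i))) (sumF-xor (λ i → s i ∧ g i) (λ i → s i ∧ h i))

·-∧ : ∀ {k} (s g : Fin k → Bool) α → s · (λ i → g i ∧ α) ≡ s · g ∧ α
·-∧ s g α = trans (sumF-cong (λ i → sym (∧-assoc (s i) (g i) α))) (sym (∧-distribʳ-sumF α (λ i → s i ∧ g i)))

-- Bipartite graphs and local complementation

module BipartiteProperties {n} {G : Graph n} (BG : IsBipartite G) where
  open IsBipartite BG

  same-side⇒¬adj : ∀ {x y} → side G x ≡ side G y → adj G x y ≡ false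
  same-side⇒¬adj {x} {y} s with adj G x y in e
  ... | true  = ⊥-elim (crosses x y e s)
  ... | false = refl

  adj⇒side≡not : ∀ {x y} → adj G x y ≡ true → side G x ≡ not (side G y)
  adj⇒side≡not {x} {y} e = ¬-not (crosses x y e)

  adj⇒no-common-side : ∀ {p q x y} → adj G p q ≡ true → side G x ≡ side G y → adj G p x ∧ adj G q y ≡ false
  adj⇒no-common-side {p} {q} {x} {y} pq s = ∧-false λ px → same-side⇒¬adj (begin
    side G q             ≡⟨ adj⇒side≡not (trans (symm q p) pq) ⟩
    not (side G p)       ≡⟨ cong not (adj⇒side≡not px) ⟩
    not (not (side G x)) ≡⟨ not-involutive _ ⟩
    side G x             ≡⟨ s ⟩
    side G y             ∎)

adj-localComp-≢ : ∀ {n} (K : Graph n) w {x y} → x ≢ y →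
  adj (localComp K w) x y ≡ (adj K w x ∧ adj K w y) xor adj K x y
adj-localComp-≢ K w {x} {y} x≢y =
  trans (cong (λ b → if not b ∧ adj K w x ∧ adj K w y then not (adj K x y) else adj K x y) (⌊≟⌋-≢ x≢y))
        (if-as-xor (adj K w x ∧ adj K w y) (adj K x y))

adj-localComp-diag : ∀ {n} (K : Graph n) w x → adj (localComp K w) x x ≡ adj K x x
adj-localComp-diag K w x =
  cong (λ b → if not b ∧ adj K w x ∧ adj K w x then not (adj K x x) else adj K x x) (⌊≟⌋-refl x)

localComp-symm : ∀ {n} (K : Graph n) w → (∀ x y → adj K x y ≡ adj K y x) →
  ∀ x y → adj (localComp K w) x y ≡ adj (localComp K w) y x
localComp-symm K w symm x y = by-cases (x ≟ y)
  where
  by-cases : Dec (x ≡ y) → adj (localComp K w) x y ≡ adj (localComp K w) y x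
  by-cases (yes refl) = refl
  by-cases (no x≢y)   = begin
    adj (localComp K w) x y               ≡⟨ adj-localComp-≢ K w x≢y ⟩
    (adj K w x ∧ adj K w y) xor adj K x y ≡⟨ cong₂ _xor_ (∧-comm (adj K w x) _) (symm x y) ⟩
    (adj K w y ∧ adj K w x) xor adj K y x ≡⟨ sym (adj-localComp-≢ K w (≢-sym x≢y)) ⟩
    adj (localComp K w) y x               ∎

data Position {n} (u v z : Fin n) : Set where
  at-u      : z ≡ u → Position u v z
  at-v      : z ≡ v → Position u v z
  elsewhere : z ≢ u → z ≢ v → Position u v z

position : ∀ {n} (u v z : Fin n) → Position u v z
position u v z with z ≟ u | z ≟ v
... | yes z≡u | _       = at-u z≡u
... | no  _   | yes z≡v = at-v z≡v
... | no z≢u  | no z≢v  = elsewhere z≢u z≢v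

-- Pivoting on an edge of a bipartite graph

module Pivot {n} {G : Graph n} (BG : IsBipartite G) {u v : Fin n} (uv : adj G u v ≡ true) where
  open IsBipartite BG
  open BipartiteProperties BG

  private
    a : Fin n → Fin n → Bool
    a = adj G
    G₁ G₂ P : Graph n
    G₁ = localComp G u
    G₂ = localComp G₁ v
    P  = pivot G u v

  u≢v : u ≢ v
  u≢v refl = true≢false (trans (sym uv) (irrefl u))

  private
    v≢u : v ≢ u
    v≢u = ≢-sym u≢v

    no-common-neighbour : ∀ x → a u x ∧ a v x ≡ false
    no-common-neighbour x = adj⇒no-common-side uv refl

    G₁-vu : adj G₁ v u ≡ true
    G₁-vu = trans (adj-localComp-≢ G u v≢u)
                  (trans (cong₂ (λ p q → (p ∧ q) xor a v u) uv (irrefl u)) (trans (symm v u) uv))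

    G₁-v : ∀ z → z ≢ v → adj G₁ v z ≡ a u z xor a v z
    G₁-v z z≢v = trans (adj-localComp-≢ G u (≢-sym z≢v)) (cong (λ p → (p ∧ a u z) xor a v z) uv)

    G₁-u : ∀ z → z ≢ u → adj G₁ u z ≡ a u z
    G₁-u z z≢u = trans (adj-localComp-≢ G u (≢-sym z≢u)) (cong (λ p → (p ∧ a u z) xor a u z) (irrefl u))

    G₁-vv : adj G₁ v v ≡ false
    G₁-vv = trans (adj-localComp-diag G u v) (irrefl v)

    G₂-uu : adj G₂ u u ≡ false
    G₂-uu = trans (adj-localComp-diag G₁ v u) (trans (adj-localComp-diag G u u) (irrefl u))

    G₂-u : ∀ z → z ≢ u → z ≢ v → adj G₂ u z ≡ a v z
    G₂-u z z≢u z≢v = begin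
      adj G₂ u z                                          ≡⟨ adj-localComp-≢ G₁ v (≢-sym z≢u) ⟩
      (adj G₁ v u ∧ adj G₁ v z) xor adj G₁ u z            ≡⟨ cong₂ (λ p q → (p ∧ q) xor adj G₁ u z) G₁-vu (G₁-v z z≢v) ⟩
      (true ∧ (a u z xor a v z)) xor adj G₁ u z           ≡⟨ cong ((a u z xor a v z) xor_) (G₁-u z z≢u) ⟩
      (a u z xor a v z) xor a u z                         ≡⟨ cancel (a u z) (a v z) ⟩
      a v z                                               ∎
      where
      cancel : ∀ x y → (x xor y) xor x ≡ y
      cancel true  true  = refl
      cancel true  false = refl
      cancel false y     = xor-identityʳ y

    G₂-uv : adj G₂ u v ≡ true
    G₂-uv = trans (adj-localComp-≢ G₁ v u≢v)
      (trans (cong₂ (λ p q → (p ∧ q) xor adj G₁ u v) G₁-vu G₁-vv)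
             (trans (adj-localComp-≢ G u u≢v) (cong₂ (λ p q → (p ∧ q) xor q) (irrefl u) uv)))

    G₂-v : ∀ z → z ≢ v → adj G₂ v z ≡ a u z xor a v z
    G₂-v z z≢v = trans (adj-localComp-≢ G₁ v (≢-sym z≢v))
      (trans (cong (λ p → (p ∧ adj G₁ v z) xor adj G₁ v z) G₁-vv) (G₁-v z z≢v))

  adj-symm : ∀ x y → adj P x y ≡ adj P y x
  adj-symm = localComp-symm G₂ u (localComp-symm G₁ v (localComp-symm G u symm))

  adj-diag : ∀ x → adj P x x ≡ false
  adj-diag x = trans (adj-localComp-diag G₂ u x)
                 (trans (adj-localComp-diag G₁ v x) (trans (adj-localComp-diag G u x) (irrefl x)))

  adj-uv : adj P u v ≡ true
  adj-uv = trans (adj-localComp-≢ G₂ u u≢v) (trans (cong (λ p → (p ∧ adj G₂ u v) xor adj G₂ u v) G₂-uu) G₂-uv)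

  adj-u : ∀ y → y ≢ u → y ≢ v → adj P u y ≡ a v y
  adj-u y y≢u y≢v = trans (adj-localComp-≢ G₂ u (≢-sym y≢u))
    (trans (cong (λ p → (p ∧ adj G₂ u y) xor adj G₂ u y) G₂-uu) (G₂-u y y≢u y≢v))

  adj-v : ∀ y → y ≢ u → y ≢ v → adj P v y ≡ a u y
  adj-v y y≢u y≢v = begin
    adj P v y                                    ≡⟨ adj-localComp-≢ G₂ u (≢-sym y≢v) ⟩
    (adj G₂ u v ∧ adj G₂ u y) xor adj G₂ v y     ≡⟨ cong₂ (λ p q → (p ∧ q) xor adj G₂ v y) G₂-uv (G₂-u y y≢u y≢v) ⟩
    a v y xor adj G₂ v y                         ≡⟨ cong (a v y xor_) (G₂-v y y≢v) ⟩
    a v y xor (a u y xor a v y)                  ≡⟨ cancel (a v y) (a u y) ⟩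
    a u y                                        ∎
    where
    cancel : ∀ x y → x xor (y xor x) ≡ y
    cancel true  true  = refl
    cancel true  false = refl
    cancel false y     = xor-identityʳ y

  adj-to-u : ∀ x → x ≢ u → x ≢ v → adj P x u ≡ a x v
  adj-to-u x x≢u x≢v = trans (adj-symm x u) (trans (adj-u x x≢u x≢v) (symm v x))

  adj-to-v : ∀ x → x ≢ u → x ≢ v → adj P x v ≡ a x u
  adj-to-v x x≢u x≢v = trans (adj-symm x v) (trans (adj-v x x≢u x≢v) (symm u x))

  adj-elsewhere : ∀ x y → x ≢ u → x ≢ v → y ≢ u → y ≢ v →
    adj P x y ≡ a x y xor ((a u x ∧ a v y) xor (a v x ∧ a u y))
  adj-elsewhere x y x≢u x≢v y≢u y≢v = by-cases (x ≟ y)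
    where
    diagonal : ∀ x → a x x xor ((a u x ∧ a v x) xor (a v x ∧ a u x)) ≡ false
    diagonal x = begin
      a x x xor ((a u x ∧ a v x) xor (a v x ∧ a u x)) ≡⟨ cong₂ (λ p q → p xor (q xor (a v x ∧ a u x))) (irrefl x) (no-common-neighbour x) ⟩
      a v x ∧ a u x                                   ≡⟨ ∧-comm (a v x) (a u x) ⟩
      a u x ∧ a v x                                   ≡⟨ no-common-neighbour x ⟩
      false                                           ∎
    expand : ∀ p q r s t → p ∧ q ≡ false → r ∧ s ≡ false →
      (q ∧ s) xor (((p xor q) ∧ (r xor s)) xor ((p ∧ r) xor t)) ≡ t xor ((p ∧ s) xor (q ∧ r))
    expand true  true  r     s     t     ()
    expand p     q     true  true  t     _ ()
    expand true  false true  false true  _ _ = refl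
    expand true  false true  false false _ _ = refl
    expand true  false false true  true  _ _ = refl
    expand true  false false true  false _ _ = refl
    expand true  false false false true  _ _ = refl
    expand true  false false false false _ _ = refl
    expand false true  true  false true  _ _ = refl
    expand false true  true  false false _ _ = refl
    expand false true  false true  true  _ _ = refl
    expand false true  false true  false _ _ = refl
    expand false true  false false true  _ _ = refl
    expand false true  false false false _ _ = refl
    expand false false true  false true  _ _ = refl
    expand false false true  false false _ _ = refl
    expand false false false true  true  _ _ = refl
    expand false false false true  false _ _ = refl
    expand false false false false true  _ _ = refl
    expand false false false false false _ _ = refl
    by-cases : Dec (x ≡ y) → adj P x y ≡ a x y xor ((a u x ∧ a v y) xor (a v x ∧ a u y))
    by-cases (yes refl) = trans (adj-diag x) (sym (diagonal x))
    by-cases (no x≢y) = begin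
      adj P x y
        ≡⟨ adj-localComp-≢ G₂ u x≢y ⟩
      (adj G₂ u x ∧ adj G₂ u y) xor adj G₂ x y
        ≡⟨ cong₂ (λ p q → (p ∧ q) xor adj G₂ x y) (G₂-u x x≢u x≢v) (G₂-u y y≢u y≢v) ⟩
      (a v x ∧ a v y) xor adj G₂ x y
        ≡⟨ cong ((a v x ∧ a v y) xor_) (adj-localComp-≢ G₁ v x≢y) ⟩
      (a v x ∧ a v y) xor ((adj G₁ v x ∧ adj G₁ v y) xor adj G₁ x y)
        ≡⟨ cong₂ (λ p q → (a v x ∧ a v y) xor ((p ∧ q) xor adj G₁ x y)) (G₁-v x x≢v) (G₁-v y y≢v) ⟩
      (a v x ∧ a v y) xor (((a u x xor a v x) ∧ (a u y xor a v y)) xor adj G₁ x y)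
        ≡⟨ cong (λ p → (a v x ∧ a v y) xor (((a u x xor a v x) ∧ (a u y xor a v y)) xor p)) (adj-localComp-≢ G u x≢y) ⟩
      (a v x ∧ a v y) xor (((a u x xor a v x) ∧ (a u y xor a v y)) xor ((a u x ∧ a u y) xor a x y))
        ≡⟨ expand (a u x) (a v x) (a u y) (a v y) (a x y) (no-common-neighbour x) (no-common-neighbour y) ⟩
      a x y xor ((a u x ∧ a v y) xor (a v x ∧ a u y))
        ∎

  side-u : side P u ≡ side G v
  side-u = cong (λ p → if p then side G v else (if ⌊ u ≟ v ⌋ then side G u else side G u)) (⌊≟⌋-refl u)

  side-v : side P v ≡ side G u
  side-v = cong₂ (λ p q → if p then side G v else (if q then side G u else side G v)) (⌊≟⌋-≢ v≢u) (⌊≟⌋-refl v)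

  side-elsewhere : ∀ x → x ≢ u → x ≢ v → side P x ≡ side G x
  side-elsewhere x x≢u x≢v =
    cong₂ (λ p q → if p then side G v else (if q then side G u else side G x)) (⌊≟⌋-≢ x≢u) (⌊≟⌋-≢ x≢v)

  private
    crosses-from-u : ∀ {y} → Position u v y → adj P u y ≡ true → side P u ≢ side P y
    crosses-from-u (at-u refl) h _ = true≢false (trans (sym h) (adj-diag u))
    crosses-from-u (at-v refl) _ s = crosses u v uv (sym (trans (sym side-u) (trans s side-v)))
    crosses-from-u {y} (elsewhere y≢u y≢v) h s =
      crosses v y (trans (sym (adj-u y y≢u y≢v)) h) (trans (sym side-u) (trans s (side-elsewhere y y≢u y≢v)))

    crosses-from-v : ∀ {y} → Position u v y → adj P v y ≡ true → side P v ≢ side P y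
    crosses-from-v (at-u refl) _ s = crosses u v uv (trans (sym side-v) (trans s side-u))
    crosses-from-v (at-v refl) h _ = true≢false (trans (sym h) (adj-diag v))
    crosses-from-v {y} (elsewhere y≢u y≢v) h s =
      crosses u y (trans (sym (adj-v y y≢u y≢v)) h) (trans (sym side-v) (trans s (side-elsewhere y y≢u y≢v)))

    crosses-elsewhere : ∀ {x y} → x ≢ u → x ≢ v → y ≢ u → y ≢ v → adj P x y ≡ true → side P x ≢ side P y
    crosses-elsewhere {x} {y} x≢u x≢v y≢u y≢v h s = true≢false (begin
      true                                            ≡⟨ sym h ⟩
      adj P x y                                       ≡⟨ adj-elsewhere x y x≢u x≢v y≢u y≢v ⟩
      a x y xor ((a u x ∧ a v y) xor (a v x ∧ a u y)) ≡⟨ cong₂ (λ p q → p xor (q xor (a v x ∧ a u y)))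
                                                           (same-side⇒¬adj sG) (adj⇒no-common-side uv sG) ⟩
      a v x ∧ a u y                                   ≡⟨ adj⇒no-common-side (trans (symm v u) uv) sG ⟩
      false                                           ∎)
      where
      sG : side G x ≡ side G y
      sG = trans (sym (side-elsewhere x x≢u x≢v)) (trans s (side-elsewhere y y≢u y≢v))

  crosses-P : ∀ x y → adj P x y ≡ true → side P x ≢ side P y
  crosses-P x y h with position u v x | position u v y
  ... | at-u refl | py = crosses-from-u py h
  ... | at-v refl | py = crosses-from-v py h
  ... | elsewhere x≢u x≢v | at-u refl =
        λ s → crosses-from-u (elsewhere x≢u x≢v) (trans (adj-symm u x) h) (sym s)
  ... | elsewhere x≢u x≢v | at-v refl =
        λ s → crosses-from-v (elsewhere x≢u x≢v) (trans (adj-symm v x) h) (sym s)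
  ... | elsewhere x≢u x≢v | elsewhere y≢u y≢v = crosses-elsewhere x≢u x≢v y≢u y≢v h

  isBipartite : IsBipartite P
  isBipartite = record { symm = adj-symm ; irrefl = adj-diag ; crosses = crosses-P }

≐-sym : ∀ {n} {G H : Graph n} → G ≐ H → H ≐ G
≐-sym (ea , es) = (λ i j → sym (ea i j)) , (λ i → sym (es i))

≐-trans : ∀ {n} {G H K : Graph n} → G ≐ H → H ≐ K → G ≐ K
≐-trans (ea , es) (ea' , es') = (λ i j → trans (ea i j) (ea' i j)) , (λ i → trans (es i) (es' i))

restrict-cong : ∀ {n m} {G H : Graph n} → G ≐ H → (e : Fin m → Fin n) → restrict G e ≐ restrict H e
restrict-cong (ea , es) e = (λ i j → ea (e i) (e j)) , (λ i → es (e i))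

localComp-cong : ∀ {n} {G H : Graph n} → (∀ i j → adj G i j ≡ adj H i j) →
  ∀ w i j → adj (localComp G w) i j ≡ adj (localComp H w) i j
localComp-cong eq w i j rewrite eq w i | eq w j | eq i j = refl

pivot-cong : ∀ {n} {G H : Graph n} → G ≐ H → ∀ u v → pivot G u v ≐ pivot H u v
pivot-cong {G = G} {H} (ea , es) u v =
  localComp-cong {G = localComp (localComp G u) v} {localComp (localComp H u) v}
    (localComp-cong {G = localComp G u} {localComp H u} (localComp-cong {G = G} {H} ea u) v) u ,
  λ i → cong₃ (λ p q r → if ⌊ i ≟ u ⌋ then p else (if ⌊ i ≟ v ⌋ then q else r)) (es v) (es u) (es i)
  where
  cong₃ : ∀ {A : Set} (f : Bool → Bool → Bool → A) {p p' q q' r r'} →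
          p ≡ p' → q ≡ q' → r ≡ r' → f p q r ≡ f p' q' r'
  cong₃ f refl refl refl = refl

Pivots-respˡ-≐ : ∀ {n} {Q : Fin n → Set} {G H G' : Graph n} → G ≐ H → Pivots Q G G' →
  Σ (Graph n) λ H' → Pivots Q H H' × (G' ≐ H')
Pivots-respˡ-≐ {H = H} eq done = H , done , eq
Pivots-respˡ-≐ eq (step u v Qu Qv uv rest) with Pivots-respˡ-≐ (pivot-cong eq u v) rest
... | H' , ps , eq' = H' , step u v Qu Qv (trans (sym (proj₁ eq u v)) uv) ps , eq'

-- Row bases over GF(2)

module RowBasis {m c r : ℕ} (M : Fin m → Fin c → Bool) (rank : HasRank M r) where

  basis : Fin r → Fin m
  basis = proj₁ (proj₁ rank)

  private
    basis-injective : Injective _≡_ _≡_ basis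
    basis-injective = proj₁ (proj₂ (proj₁ rank))

    basis-independent : LinIndep (λ i → M (basis i))
    basis-independent = proj₂ (proj₂ (proj₁ rank))

  Combination : Fin m → (Fin r → Bool) → Set
  Combination x s = ∀ y → M x y ≡ s · (λ i → M (basis i) y)

  row-combination : ∀ x → Σ (Fin r → Bool) (Combination x)
  row-combination x with anySubset? (λ s → all? (λ y → M x y ≟ᵇ sumF (λ i → lookup s i ∧ M (basis i) y)))
  ... | yes (s , comb) = lookup s , comb
  ... | no no-comb = ⊥-elim (1+n≰n (proj₂ rank (suc r) extended extended-injective extended-independent))
    where
    no-combination : ∀ s → ¬ Combination x s
    no-combination s comb = no-comb (tabulate s , λ y →
      trans (comb y) (sumF-cong (λ i → cong (_∧ M (basis i) y) (sym (lookup∘tabulate s i)))))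

    extended : Fin (suc r) → Fin m
    extended fz     = x
    extended (fs i) = basis i

    ∉basis : ∀ j → x ≢ basis j
    ∉basis j x≡bj = no-combination (λ i → ⌊ i ≟ j ⌋)
      (λ y → trans (cong (λ z → M z y) x≡bj) (sym (sumF-indicator (λ i → M (basis i) y) j)))

    extended-injective : Injective _≡_ _≡_ extended
    extended-injective {fz}   {fz}   _ = refl
    extended-injective {fz}   {fs j} e = ⊥-elim (∉basis j e)
    extended-injective {fs i} {fz}   e = ⊥-elim (∉basis i (sym e))
    extended-injective {fs i} {fs j} e = cong fs (basis-injective e)

    extended-independent : LinIndep (λ i → M (extended i))
    extended-independent s dep with s fz in s₀
    ... | true  = ⊥-elim (no-combination (λ i → s (fs i)) (λ y → xor-false⇒≡ (dep y)))
    ... | false = λ { fz → s₀ ; (fs i) → basis-independent (λ i → s (fs i)) dep i }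

-- Pivoting outside X

module PivotsAvoiding {n m r : ℕ} (G : Graph n) (X : Fin n → Bool)
    (ι : Fin m → Fin n) (ι∈X : ∀ x → X (ι x) ≡ true)
    (basis : Fin r → Fin m) (c : Fin m → Fin r → Bool) where

  bilinear : (Fin r → Fin r → Bool) → Fin m → Fin m → Bool
  bilinear T x x' = sumF (λ i → sumF (λ j → (c x i ∧ c x' j) ∧ T i j))

  bilinear-cong : ∀ {T T'} → (∀ i j → T i j ≡ T' i j) → ∀ x x' → bilinear T x x' ≡ bilinear T' x x'
  bilinear-cong e x x' = sumF-cong (λ i → sumF-cong (λ j → cong ((c x i ∧ c x' j) ∧_) (e i j)))

  bilinear-xor : ∀ T T' x x' → bilinear (λ i j → T i j xor T' i j) x x' ≡ bilinear T x x' xor bilinear T' x x'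
  bilinear-xor T T' x x' = begin
    bilinear (λ i j → T i j xor T' i j) x x'
      ≡⟨ sumF-cong (λ i → ·-xor (λ j → c x i ∧ c x' j) (T i) (T' i)) ⟩
    sumF (λ i → sumF (λ j → (c x i ∧ c x' j) ∧ T i j) xor sumF (λ j → (c x i ∧ c x' j) ∧ T' i j))
      ≡⟨ sumF-xor (λ i → sumF (λ j → (c x i ∧ c x' j) ∧ T i j)) _ ⟩
    bilinear T x x' xor bilinear T' x x'
      ∎

  bilinear-product : ∀ g h x x' → c x · g ∧ c x' · h ≡ bilinear (λ i j → g i ∧ h j) x x'
  bilinear-product g h x x' = sumF-bilinear (c x) g (c x') h

  difference : Graph n → Fin r → Fin r → Bool
  difference K i j = adj K (ι (basis i)) (ι (basis j)) xor adj G (ι (basis i)) (ι (basis j))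

  record Invariant (K : Graph n) : Set where
    field
      bipartite    : IsBipartite K
      sides        : ∀ x → side K (ι x) ≡ side G (ι x)
      rows-combine : ∀ x y → X y ≡ false → adj K (ι x) y ≡ c x · (λ i → adj K (ι (basis i)) y)
      change       : ∀ x x' → adj K (ι x) (ι x') xor adj G (ι x) (ι x') ≡ bilinear (difference K) x x'

  ι∉ : ∀ {u} x → X u ≡ false → ι x ≢ u
  ι∉ x Xu refl = true≢false (trans (sym (ι∈X x)) Xu)

  invariant-pivot : ∀ {K u v} → Invariant K → X u ≡ false → X v ≡ false → (uv : adj K u v ≡ true) →
    Invariant (pivot K u v)
  invariant-pivot {K} {u} {v} inv Xu Xv uv = record
    { bipartite = isBipartite ; sides = sides′ ; rows-combine = rows-combine′ ; change = change′ }
    where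
    open Invariant inv
    open IsBipartite bipartite
    open Pivot bipartite uv

    a : Fin n → Fin n → Bool
    a = adj K
    P : Graph n
    P = pivot K u v

    U V : Fin r → Bool
    U i = a u (ι (basis i))
    V i = a v (ι (basis i))

    ≢u : ∀ x → ι x ≢ u
    ≢u x = ι∉ x Xu
    ≢v : ∀ x → ι x ≢ v
    ≢v x = ι∉ x Xv

    row-u : ∀ x → a u (ι x) ≡ c x · U
    row-u x = trans (symm u (ι x)) (trans (rows-combine x u Xu) (·-cong (c x) (λ i → symm (ι (basis i)) u)))
    row-v : ∀ x → a v (ι x) ≡ c x · V
    row-v x = trans (symm v (ι x)) (trans (rows-combine x v Xv) (·-cong (c x) (λ i → symm (ι (basis i)) v)))

    sides′ : ∀ x → side P (ι x) ≡ side G (ι x)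
    sides′ x = trans (side-elsewhere (ι x) (≢u x) (≢v x)) (sides x)

    rows-combine′ : ∀ x y → X y ≡ false → adj P (ι x) y ≡ c x · (λ i → adj P (ι (basis i)) y)
    rows-combine′ x y Xy with position u v y
    ... | at-u refl = begin
      adj P (ι x) u                       ≡⟨ adj-to-u (ι x) (≢u x) (≢v x) ⟩
      a (ι x) v                           ≡⟨ rows-combine x v Xv ⟩
      c x · (λ i → a (ι (basis i)) v)     ≡⟨ ·-cong (c x) (λ i → sym (adj-to-u (ι (basis i)) (≢u _) (≢v _))) ⟩
      c x · (λ i → adj P (ι (basis i)) u) ∎
    ... | at-v refl = begin
      adj P (ι x) v                       ≡⟨ adj-to-v (ι x) (≢u x) (≢v x) ⟩
      a (ι x) u                           ≡⟨ rows-combine x u Xu ⟩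
      c x · (λ i → a (ι (basis i)) u)     ≡⟨ ·-cong (c x) (λ i → sym (adj-to-v (ι (basis i)) (≢u _) (≢v _))) ⟩
      c x · (λ i → adj P (ι (basis i)) v) ∎
    ... | elsewhere y≢u y≢v = begin
      adj P (ι x) y
        ≡⟨ adj-elsewhere (ι x) y (≢u x) (≢v x) y≢u y≢v ⟩
      a (ι x) y xor ((a u (ι x) ∧ a v y) xor (a v (ι x) ∧ a u y))
        ≡⟨ cong₂ _xor_ (rows-combine x y Xy) (cong₂ _xor_ (cong (_∧ a v y) (row-u x)) (cong (_∧ a u y) (row-v x))) ⟩
      c x · Y xor ((c x · U ∧ a v y) xor (c x · V ∧ a u y))
        ≡⟨ sym (trans (·-xor (c x) Y _) (cong (c x · Y xor_)
             (trans (·-xor (c x) (λ i → U i ∧ a v y) _) (cong₂ _xor_ (·-∧ (c x) U (a v y)) (·-∧ (c x) V (a u y)))))) ⟩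
      c x · (λ i → Y i xor ((U i ∧ a v y) xor (V i ∧ a u y)))
        ≡⟨ ·-cong (c x) (λ i → sym (adj-elsewhere (ι (basis i)) y (≢u _) (≢v _) y≢u y≢v)) ⟩
      c x · (λ i → adj P (ι (basis i)) y)
        ∎
      where
      Y : Fin r → Bool
      Y i = a (ι (basis i)) y

    toggle : Fin n → Fin n → Bool
    toggle p q = (a u p ∧ a v q) xor (a v p ∧ a u q)

    pivot-toggles : ∀ x x' → adj P (ι x) (ι x') ≡ a (ι x) (ι x') xor toggle (ι x) (ι x')
    pivot-toggles x x' = adj-elsewhere (ι x) (ι x') (≢u x) (≢v x) (≢u x') (≢v x')

    toggle-bilinear : ∀ x x' → toggle (ι x) (ι x') ≡ bilinear (λ i j → toggle (ι (basis i)) (ι (basis j))) x x'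
    toggle-bilinear x x' = begin
      (a u (ι x) ∧ a v (ι x')) xor (a v (ι x) ∧ a u (ι x'))
        ≡⟨ cong₂ _xor_ (cong₂ _∧_ (row-u x) (row-v x')) (cong₂ _∧_ (row-v x) (row-u x')) ⟩
      (c x · U ∧ c x' · V) xor (c x · V ∧ c x' · U)
        ≡⟨ cong₂ _xor_ (bilinear-product U V x x') (bilinear-product V U x x') ⟩
      bilinear (λ i j → U i ∧ V j) x x' xor bilinear (λ i j → V i ∧ U j) x x'
        ≡⟨ sym (bilinear-xor (λ i j → U i ∧ V j) (λ i j → V i ∧ U j) x x') ⟩
      bilinear (λ i j → toggle (ι (basis i)) (ι (basis j))) x x'
        ∎

    change′ : ∀ x x' → adj P (ι x) (ι x') xor adj G (ι x) (ι x') ≡ bilinear (difference P) x x'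
    change′ x x' = begin
      adj P (ι x) (ι x') xor adj G (ι x) (ι x')
        ≡⟨ cong (_xor adj G (ι x) (ι x')) (pivot-toggles x x') ⟩
      (a (ι x) (ι x') xor toggle (ι x) (ι x')) xor adj G (ι x) (ι x')
        ≡⟨ xor-rightComm (a (ι x) (ι x')) _ _ ⟩
      (a (ι x) (ι x') xor adj G (ι x) (ι x')) xor toggle (ι x) (ι x')
        ≡⟨ cong₂ _xor_ (change x x') (toggle-bilinear x x') ⟩
      bilinear (difference K) x x' xor bilinear (λ i j → toggle (ι (basis i)) (ι (basis j))) x x'
        ≡⟨ sym (bilinear-xor (difference K) _ x x') ⟩
      bilinear (λ i j → difference K i j xor toggle (ι (basis i)) (ι (basis j))) x x'
        ≡⟨ bilinear-cong (λ i j → trans (xor-rightComm (a (ι (basis i)) (ι (basis j))) _ _)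
                                         (cong (_xor adj G _ _) (sym (pivot-toggles (basis i) (basis j))))) x x' ⟩
      bilinear (difference P) x x'
        ∎

  invariant-Pivots : ∀ {K K'} → Invariant K → Pivots (λ v → X v ≡ false) K K' → Invariant K'
  invariant-Pivots inv done                         = inv
  invariant-Pivots inv (step u v Xu Xv uv pivots) = invariant-Pivots (invariant-pivot inv Xu Xv uv) pivots

-- The gadget: new edges aₖbₖ attached to B whose pivots add Σₖ toggle k to B.

module Gadget {m len : ℕ} {B : Graph m} (BB : IsBipartite B) (β : Bool)
    (Pv Qv : Fin len → Fin m → Bool)
    (P-side : ∀ k x → Pv k x ≡ true → side B x ≡ β)
    (Q-side : ∀ k x → Qv k x ≡ true → side B x ≡ not β) where

  open IsBipartite BB renaming (symm to B-symm; irrefl to B-irrefl)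

  toggle : Fin len → Fin m → Fin m → Bool
  toggle k x y = (Pv k x ∧ Qv k y) xor (Qv k x ∧ Pv k y)

  toggled : Graph m
  toggled = mkGraph (λ x y → adj B x y xor sumF (λ k → toggle k x y)) (side B)

  data Vertex : Set where
    old : Fin m → Vertex
    a b : Fin len → Vertex

  N : ℕ
  N = m + (len + len)

  encode : Vertex → Fin N
  encode (old x) = join m (len + len) (inj₁ x)
  encode (a k)   = join m (len + len) (inj₂ (join len len (inj₁ k)))
  encode (b k)   = join m (len + len) (inj₂ (join len len (inj₂ k)))

  decode : Fin N → Vertex
  decode v with splitAt m v
  ... | inj₁ x = old x
  ... | inj₂ w with splitAt len w
  ...   | inj₁ k = a k
  ...   | inj₂ k = b k

  decode-encode : ∀ p → decode (encode p) ≡ p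
  decode-encode (old x) rewrite splitAt-join m (len + len) (inj₁ x) = refl
  decode-encode (a k) rewrite splitAt-join m (len + len) (inj₂ (join len len (inj₁ k)))
                            | splitAt-join len len (inj₁ k) = refl
  decode-encode (b k) rewrite splitAt-join m (len + len) (inj₂ (join len len (inj₂ k)))
                            | splitAt-join len len (inj₂ k) = refl

  encode-decode : ∀ v → encode (decode v) ≡ v
  encode-decode v with splitAt m v | join-splitAt m (len + len) v
  ... | inj₁ x | e = e
  ... | inj₂ w | e with splitAt len w | join-splitAt len len w
  ...   | inj₁ k | e' = trans (cong (λ z → join m (len + len) (inj₂ z)) e') e
  ...   | inj₂ k | e' = trans (cong (λ z → join m (len + len) (inj₂ z)) e') e

  decode≡⇒≡encode : ∀ {v p} → decode v ≡ p → v ≡ encode p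
  decode≡⇒≡encode {v} refl = sym (encode-decode v)

  encode-injective : Injective _≡_ _≡_ encode
  encode-injective {p} {q} e = trans (sym (decode-encode p)) (trans (cong decode e) (decode-encode q))

  -- S k records whether the edge aₖbₖ has been pivoted.
  adjᵛ : (Fin len → Bool) → Vertex → Vertex → Bool
  adjᵛ S (old x) (old y) = adj B x y xor sumF (λ k → S k ∧ toggle k x y)
  adjᵛ S (old x) (a k)   = if S k then Qv k x else Pv k x
  adjᵛ S (old x) (b k)   = if S k then Pv k x else Qv k x
  adjᵛ S (a k)   (old x) = if S k then Qv k x else Pv k x
  adjᵛ S (b k)   (old x) = if S k then Pv k x else Qv k x
  adjᵛ S (a k)   (b l)   = ⌊ k ≟ l ⌋
  adjᵛ S (b l)   (a k)   = ⌊ k ≟ l ⌋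
  adjᵛ S (a _)   (a _)   = false
  adjᵛ S (b _)   (b _)   = false

  sideᵛ : (Fin len → Bool) → Vertex → Bool
  sideᵛ S (old x) = side B x
  sideᵛ S (a k)   = if S k then β else not β
  sideᵛ S (b k)   = if S k then not β else β

  H : (Fin len → Bool) → Graph N
  H S = mkGraph (λ v w → adjᵛ S (decode v) (decode w)) (λ v → sideᵛ S (decode v))

  H-cong : ∀ {S S'} → (∀ k → S k ≡ S' k) → H S ≐ H S'
  H-cong {S} {S'} e = (λ v w → adj-cong (decode v) (decode w)) , (λ v → side-cong (decode v))
    where
    adj-cong : ∀ p q → adjᵛ S p q ≡ adjᵛ S' p q
    adj-cong (old x) (old y) = cong (adj B x y xor_) (sumF-cong (λ k → cong (_∧ toggle k x y) (e k)))
    adj-cong (old x) (a k) rewrite e k = refl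
    adj-cong (old x) (b k) rewrite e k = refl
    adj-cong (a k) (old x) rewrite e k = refl
    adj-cong (b k) (old x) rewrite e k = refl
    adj-cong (a k) (b l)   = refl
    adj-cong (b l) (a k)   = refl
    adj-cong (a _) (a _)   = refl
    adj-cong (b _) (b _)   = refl
    side-cong : ∀ p → sideᵛ S p ≡ sideᵛ S' p
    side-cong (old x) = refl
    side-cong (a k) rewrite e k = refl
    side-cong (b k) rewrite e k = refl

  private
    x≢not-x : ∀ {x : Bool} → x ≢ not x
    x≢not-x = not-¬ refl

    toggle-symm : ∀ k x y → toggle k x y ≡ toggle k y x
    toggle-symm k x y = trans (xor-comm (Pv k x ∧ Qv k y) _)
                              (cong₂ _xor_ (∧-comm (Qv k x) (Pv k y)) (∧-comm (Pv k x) (Qv k y)))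

    toggle-same-side : ∀ k {x y} → side B x ≡ side B y → toggle k x y ≡ false
    toggle-same-side k {x} {y} s = cong₂ _xor_ (P∧Q≡false s) (trans (∧-comm (Qv k x) (Pv k y)) (P∧Q≡false (sym s)))
      where
      P∧Q≡false : ∀ {x y} → side B x ≡ side B y → Pv k x ∧ Qv k y ≡ false
      P∧Q≡false {x} {y} s with Pv k x in px | Qv k y in qy
      ... | true  | true  = ⊥-elim (x≢not-x (trans (sym (P-side k x px)) (trans s (Q-side k y qy))))
      ... | true  | false = refl
      ... | false | _     = refl

  adjᵛ-symm : ∀ S p q → adjᵛ S p q ≡ adjᵛ S q p
  adjᵛ-symm S (old x) (old y) = cong₂ _xor_ (B-symm x y) (sumF-cong (λ k → cong (S k ∧_) (toggle-symm k x y)))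
  adjᵛ-symm S (old x) (a k)   = refl
  adjᵛ-symm S (old x) (b k)   = refl
  adjᵛ-symm S (a k)   (old x) = refl
  adjᵛ-symm S (b k)   (old x) = refl
  adjᵛ-symm S (a k)   (b l)   = refl
  adjᵛ-symm S (b l)   (a k)   = refl
  adjᵛ-symm S (a _)   (a _)   = refl
  adjᵛ-symm S (b _)   (b _)   = refl

  adjᵛ-irrefl : ∀ S p → adjᵛ S p p ≡ false
  adjᵛ-irrefl S (old x) = cong₂ _xor_ (B-irrefl x)
    (sumF-zero (λ k → trans (cong (S k ∧_) (toggle-same-side k refl)) (∧-zeroʳ (S k))))
  adjᵛ-irrefl S (a k) = refl
  adjᵛ-irrefl S (b k) = refl

  adjᵛ-crosses : ∀ S p q → adjᵛ S p q ≡ true → sideᵛ S p ≢ sideᵛ S q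
  adjᵛ-crosses S (old x) (old y) h s = true≢false (trans (sym h) (cong₂ _xor_
    (BipartiteProperties.same-side⇒¬adj BB s)
    (sumF-zero (λ k → trans (cong (S k ∧_) (toggle-same-side k s)) (∧-zeroʳ (S k))))))
  adjᵛ-crosses S (old x) (a k) h s with S k
  ... | true  = x≢not-x (trans (sym s) (Q-side k x h))
  ... | false = x≢not-x (trans (sym (P-side k x h)) s)
  adjᵛ-crosses S (old x) (b k) h s with S k
  ... | true  = x≢not-x (trans (sym (P-side k x h)) s)
  ... | false = x≢not-x (trans (sym s) (Q-side k x h))
  adjᵛ-crosses S (a k) (old x) h s = adjᵛ-crosses S (old x) (a k) h (sym s)
  adjᵛ-crosses S (b k) (old x) h s = adjᵛ-crosses S (old x) (b k) h (sym s)
  adjᵛ-crosses S (a k) (b l) h s with k ≟ l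
  adjᵛ-crosses S (a k) (b .k) h s | yes refl with S k
  ... | true  = x≢not-x s
  ... | false = x≢not-x (sym s)
  adjᵛ-crosses S (b l) (a k) h s = adjᵛ-crosses S (a k) (b l) h (sym s)

  H-isBipartite : ∀ S → IsBipartite (H S)
  H-isBipartite S = record
    { symm    = λ v w → adjᵛ-symm S (decode v) (decode w)
    ; irrefl  = λ v → adjᵛ-irrefl S (decode v)
    ; crosses = λ v w → adjᵛ-crosses S (decode v) (decode w) }

  flip : (Fin len → Bool) → Fin len → Fin len → Bool
  flip S k l = S l xor ⌊ l ≟ k ⌋

  module PivotPair (S : Fin len → Bool) (k : Fin len) (Sk : S k ≡ false) where

    private
      S' : Fin len → Bool
      S' = flip S k

      S'k : S' k ≡ true
      S'k = cong₂ _xor_ Sk (⌊≟⌋-refl k)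

      S'l : ∀ {l} → l ≢ k → S' l ≡ S l
      S'l {l} l≢k = trans (cong (S l xor_) (⌊≟⌋-≢ l≢k)) (xor-identityʳ (S l))

      if-S' : ∀ {l} (t e : Bool) → l ≢ k → (if S' l then t else e) ≡ (if S l then t else e)
      if-S' t e l≢k = cong (λ s → if s then t else e) (S'l l≢k)

      if-true : ∀ {s : Bool} (t e : Bool) → s ≡ true → (if s then t else e) ≡ t
      if-true t e refl = refl

      if-false : ∀ {s : Bool} (t e : Bool) → s ≡ false → (if s then t else e) ≡ e
      if-false t e refl = refl

      a≢ : ∀ {l} → a l ≢ a k → l ≢ k
      a≢ ne refl = ne refl
      b≢ : ∀ {l} → b l ≢ b k → l ≢ k
      b≢ ne refl = ne refl

      unchanged : ∀ p q {t t'} → t ≡ t' →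
        adjᵛ S (a k) p ∧ adjᵛ S (b k) q ≡ false → adjᵛ S (b k) p ∧ adjᵛ S (a k) q ≡ false →
        t ≡ t' xor ((adjᵛ S (a k) p ∧ adjᵛ S (b k) q) xor (adjᵛ S (b k) p ∧ adjᵛ S (a k) q))
      unchanged p q {t} refl e₁ e₂ = sym (trans (cong₂ (λ e e' → t xor (e xor e')) e₁ e₂) (xor-identityʳ t))

    adjᵛ-a : ∀ q → q ≢ a k → q ≢ b k → adjᵛ S' (a k) q ≡ adjᵛ S (b k) q
    adjᵛ-a (old x) _ _    = trans (if-true (Qv k x) (Pv k x) S'k) (sym (if-false (Pv k x) (Qv k x) Sk))
    adjᵛ-a (a l) q≢ak _   = sym (⌊≟⌋-≢ (a≢ q≢ak))
    adjᵛ-a (b l) _ q≢bk   = ⌊≟⌋-≢ (≢-sym (b≢ q≢bk))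

    adjᵛ-b : ∀ q → q ≢ a k → q ≢ b k → adjᵛ S' (b k) q ≡ adjᵛ S (a k) q
    adjᵛ-b (old x) _ _    = trans (if-true (Pv k x) (Qv k x) S'k) (sym (if-false (Qv k x) (Pv k x) Sk))
    adjᵛ-b (a l) q≢ak _   = ⌊≟⌋-≢ (a≢ q≢ak)
    adjᵛ-b (b l) _ q≢bk   = sym (⌊≟⌋-≢ (≢-sym (b≢ q≢bk)))

    adjᵛ-elsewhere : ∀ p q → p ≢ a k → p ≢ b k → q ≢ a k → q ≢ b k →
      adjᵛ S' p q ≡ adjᵛ S p q xor ((adjᵛ S (a k) p ∧ adjᵛ S (b k) q) xor (adjᵛ S (b k) p ∧ adjᵛ S (a k) q))
    adjᵛ-elsewhere (old x) (old y) _ _ _ _ rewrite Sk = begin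
      adj B x y xor sumF (λ l → S' l ∧ toggle l x y)
        ≡⟨ cong (adj B x y xor_) (trans (sumF-cong (λ l → ∧-distribʳ-xor (toggle l x y) (S l) ⌊ l ≟ k ⌋))
                                 (sumF-xor (λ l → S l ∧ toggle l x y) (λ l → ⌊ l ≟ k ⌋ ∧ toggle l x y))) ⟩
      adj B x y xor (sumF (λ l → S l ∧ toggle l x y) xor sumF (λ l → ⌊ l ≟ k ⌋ ∧ toggle l x y))
        ≡⟨ cong (λ t → adj B x y xor (sumF (λ l → S l ∧ toggle l x y) xor t)) (sumF-indicator (λ l → toggle l x y) k) ⟩
      adj B x y xor (sumF (λ l → S l ∧ toggle l x y) xor toggle k x y)
        ≡⟨ sym (xor-assoc (adj B x y) _ _) ⟩
      (adj B x y xor sumF (λ l → S l ∧ toggle l x y)) xor toggle k x y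
        ∎
    adjᵛ-elsewhere (old x) (a l) _ _ q≢ak _ =
      unchanged (old x) (a l) (if-S' (Qv l x) (Pv l x) (a≢ q≢ak)) (trans (cong (_ ∧_) (⌊≟⌋-≢ (a≢ q≢ak))) (∧-zeroʳ _)) (∧-zeroʳ _)
    adjᵛ-elsewhere (old x) (b l) _ _ _ q≢bk =
      unchanged (old x) (b l) (if-S' (Pv l x) (Qv l x) (b≢ q≢bk)) (∧-zeroʳ _) (trans (cong (_ ∧_) (⌊≟⌋-≢ (≢-sym (b≢ q≢bk)))) (∧-zeroʳ _))
    adjᵛ-elsewhere (a l) (old x) p≢ak _ _ _ =
      unchanged (a l) (old x) (if-S' (Qv l x) (Pv l x) (a≢ p≢ak)) refl (cong (_∧ _) (⌊≟⌋-≢ (a≢ p≢ak)))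
    adjᵛ-elsewhere (b l) (old x) _ p≢bk _ _ =
      unchanged (b l) (old x) (if-S' (Pv l x) (Qv l x) (b≢ p≢bk)) (cong (_∧ _) (⌊≟⌋-≢ (≢-sym (b≢ p≢bk)))) refl
    adjᵛ-elsewhere (a l) (a l') p≢ak _ _ _ = unchanged (a l) (a l') refl refl (cong (_∧ false) (⌊≟⌋-≢ (a≢ p≢ak)))
    adjᵛ-elsewhere (a l) (b l') p≢ak _ _ _ = unchanged (a l) (b l') refl refl (cong (_∧ _) (⌊≟⌋-≢ (a≢ p≢ak)))
    adjᵛ-elsewhere (b l) (a l') _ p≢bk _ _ = unchanged (b l) (a l') refl (cong (_∧ _) (⌊≟⌋-≢ (≢-sym (b≢ p≢bk)))) refl
    adjᵛ-elsewhere (b l) (b l') _ p≢bk _ _ = unchanged (b l) (b l') refl (cong (_∧ _) (⌊≟⌋-≢ (≢-sym (b≢ p≢bk)))) refl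

    sideᵛ-a : sideᵛ S' (a k) ≡ sideᵛ S (b k)
    sideᵛ-a = trans (if-true β (not β) S'k) (sym (if-false (not β) β Sk))

    sideᵛ-b : sideᵛ S' (b k) ≡ sideᵛ S (a k)
    sideᵛ-b = trans (if-true (not β) β S'k) (sym (if-false β (not β) Sk))

    sideᵛ-elsewhere : ∀ p → p ≢ a k → p ≢ b k → sideᵛ S' p ≡ sideᵛ S p
    sideᵛ-elsewhere (old x) _ _    = refl
    sideᵛ-elsewhere (a l) p≢ak _   = if-S' β (not β) (a≢ p≢ak)
    sideᵛ-elsewhere (b l) _ p≢bk   = if-S' (not β) β (b≢ p≢bk)

    edge : adj (H S) (encode (a k)) (encode (b k)) ≡ true
    edge = trans (cong₂ (adjᵛ S) (decode-encode (a k)) (decode-encode (b k))) (⌊≟⌋-refl k)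

    pivot-pair : pivot (H S) (encode (a k)) (encode (b k)) ≐ H (flip S k)
    pivot-pair = adj-eq , side-eq
      where
      open Pivot (H-isBipartite S) edge
      P = pivot (H S) (encode (a k)) (encode (b k))
      aₖ bₖ : Fin N
      aₖ = encode (a k)
      bₖ = encode (b k)

      ≢a : ∀ {w} → w ≢ aₖ → decode w ≢ a k
      ≢a w≢ e = w≢ (decode≡⇒≡encode e)
      ≢b : ∀ {w} → w ≢ bₖ → decode w ≢ b k
      ≢b w≢ e = w≢ (decode≡⇒≡encode e)

      via-decode : ∀ {w} {p : Vertex} (f : Vertex → Bool) → decode w ≡ p → f p ≡ f (decode w)
      via-decode f e = cong f (sym e)

      from-a : ∀ w → Position aₖ bₖ w → adj P aₖ w ≡ adjᵛ S' (decode aₖ) (decode w)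
      from-a _ (at-u refl) = trans (adj-diag aₖ) (via-decode (λ p → adjᵛ S' p p) (decode-encode (a k)))
      from-a _ (at-v refl) = trans adj-uv (trans (sym (⌊≟⌋-refl k))
        (cong₂ (adjᵛ S') (sym (decode-encode (a k))) (sym (decode-encode (b k)))))
      from-a w (elsewhere w≢a w≢b) = trans (adj-u w w≢a w≢b) (trans
        (cong (λ p → adjᵛ S p (decode w)) (decode-encode (b k)))
        (trans (sym (adjᵛ-a (decode w) (≢a w≢a) (≢b w≢b))) (via-decode (λ p → adjᵛ S' p (decode w)) (decode-encode (a k)))))

      from-b : ∀ w → Position aₖ bₖ w → adj P bₖ w ≡ adjᵛ S' (decode bₖ) (decode w)
      from-b _ (at-u refl) = trans (adj-symm bₖ aₖ) (trans (from-a bₖ (at-v refl)) (adjᵛ-symm S' (decode aₖ) (decode bₖ)))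
      from-b _ (at-v refl) = trans (adj-diag bₖ) (via-decode (λ p → adjᵛ S' p p) (decode-encode (b k)))
      from-b w (elsewhere w≢a w≢b) = trans (adj-v w w≢a w≢b) (trans
        (cong (λ p → adjᵛ S p (decode w)) (decode-encode (a k)))
        (trans (sym (adjᵛ-b (decode w) (≢a w≢a) (≢b w≢b))) (via-decode (λ p → adjᵛ S' p (decode w)) (decode-encode (b k)))))

      adj-eq : ∀ x y → adj P x y ≡ adjᵛ S' (decode x) (decode y)
      adj-eq x y with position aₖ bₖ x
      ... | at-u refl = from-a y (position aₖ bₖ y)
      ... | at-v refl = from-b y (position aₖ bₖ y)
      ... | elsewhere x≢a x≢b with position aₖ bₖ y
      ...   | at-u refl = trans (adj-symm x aₖ) (trans (from-a x (elsewhere x≢a x≢b)) (adjᵛ-symm S' (decode aₖ) (decode x)))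
      ...   | at-v refl = trans (adj-symm x bₖ) (trans (from-b x (elsewhere x≢a x≢b)) (adjᵛ-symm S' (decode bₖ) (decode x)))
      ...   | elsewhere y≢a y≢b = begin
        adj P x y
          ≡⟨ adj-elsewhere x y x≢a x≢b y≢a y≢b ⟩
        adjᵛ S (decode x) (decode y) xor ((adjᵛ S (decode aₖ) (decode x) ∧ adjᵛ S (decode bₖ) (decode y))
                                     xor (adjᵛ S (decode bₖ) (decode x) ∧ adjᵛ S (decode aₖ) (decode y)))
          ≡⟨ cong₂ (λ p q → adjᵛ S (decode x) (decode y) xor ((adjᵛ S p (decode x) ∧ adjᵛ S q (decode y))
                                                           xor (adjᵛ S q (decode x) ∧ adjᵛ S p (decode y))))
                   (decode-encode (a k)) (decode-encode (b k)) ⟩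
        adjᵛ S (decode x) (decode y) xor ((adjᵛ S (a k) (decode x) ∧ adjᵛ S (b k) (decode y))
                                     xor (adjᵛ S (b k) (decode x) ∧ adjᵛ S (a k) (decode y)))
          ≡⟨ sym (adjᵛ-elsewhere (decode x) (decode y) (≢a x≢a) (≢b x≢b) (≢a y≢a) (≢b y≢b)) ⟩
        adjᵛ S' (decode x) (decode y)
          ∎

      side-eq : ∀ x → side P x ≡ sideᵛ S' (decode x)
      side-eq x with position aₖ bₖ x
      ... | at-u refl = trans side-u (trans (cong (sideᵛ S) (decode-encode (b k)))
                          (trans (sym sideᵛ-a) (via-decode (sideᵛ S') (decode-encode (a k)))))
      ... | at-v refl = trans side-v (trans (cong (sideᵛ S) (decode-encode (a k)))
                          (trans (sym sideᵛ-b) (via-decode (sideᵛ S') (decode-encode (b k)))))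
      ... | elsewhere x≢a x≢b = trans (side-elsewhere x x≢a x≢b) (sym (sideᵛ-elsewhere (decode x) (≢a x≢a) (≢b x≢b)))

  prefix : ℕ → Fin len → Bool
  prefix j l = ⌊ toℕ l <? j ⌋

  flip-prefix : ∀ (k : Fin len) l → flip (prefix (toℕ k)) k l ≡ prefix (suc (toℕ k)) l
  flip-prefix k l with <-cmp (toℕ l) (toℕ k)
  ... | tri< l<k _ _ = trans (cong₂ _xor_ (⌊⌋-yes (toℕ l <? toℕ k) l<k) (⌊≟⌋-≢ λ l≡k → <-irrefl (cong toℕ l≡k) l<k))
                             (sym (⌊⌋-yes (toℕ l <? suc (toℕ k)) (m<n⇒m<1+n l<k)))
  ... | tri≈ _ l≡k _ = trans (cong₂ _xor_ (⌊⌋-no (toℕ l <? toℕ k) (<-irrefl l≡k)) (⌊⌋-yes (l ≟ k) (toℕ-injective l≡k)))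
                             (sym (⌊⌋-yes (toℕ l <? suc (toℕ k)) (s≤s (≤-reflexive l≡k))))
  ... | tri> _ _ k<l = trans (cong₂ _xor_ (⌊⌋-no (toℕ l <? toℕ k) (<⇒≱ k<l ∘ <⇒≤)) (⌊≟⌋-≢ λ l≡k → <-irrefl (cong toℕ (sym l≡k)) k<l))
                             (sym (⌊⌋-no (toℕ l <? suc (toℕ k)) (<⇒≱ k<l ∘ s≤s⁻¹)))

  prefix-irrefl : ∀ (k : Fin len) → prefix (toℕ k) k ≡ false
  prefix-irrefl k = ⌊⌋-no (toℕ k <? toℕ k) (<-irrefl refl)

  pivot-prefix : ∀ k → pivot (H (prefix (toℕ k))) (encode (a k)) (encode (b k)) ≐ H (prefix (suc (toℕ k)))
  pivot-prefix k = ≐-trans (PivotPair.pivot-pair (prefix (toℕ k)) k (prefix-irrefl k)) (H-cong (flip-prefix k))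

  RemainingPairs : ℕ → Set
  RemainingPairs j = Σ (Graph N) λ H' → Pivots (λ _ → ⊤) (H (prefix j)) H' × (H' ≐ H (λ _ → true))

  pivot-remaining-pairs : ∀ d j → d + j ≡ len → RemainingPairs j
  pivot-remaining-pairs zero j refl = H (prefix j) , done , H-cong (λ l → ⌊⌋-yes (toℕ l <? j) (toℕ<n l))
  pivot-remaining-pairs (suc d) j e = subst RemainingPairs k≡j pivot-pair-at
    where
    j<len : j < len
    j<len = subst (suc j ≤_) e (s≤s (m≤n+m j d))
    k : Fin len
    k = fromℕ< j<len
    k≡j : toℕ k ≡ j
    k≡j = toℕ-fromℕ< j<len
    pivot-pair-at : RemainingPairs (toℕ k)
    pivot-pair-at with pivot-remaining-pairs d (suc (toℕ k)) (trans (+-suc d _) (trans (cong (suc d +_) k≡j) e))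
    ... | H' , pivots , H'≐ with Pivots-respˡ-≐ (≐-sym (pivot-prefix k)) pivots
    ...   | L , pivots′ , H'≐L =
            L , step _ _ tt tt (PivotPair.edge (prefix (toℕ k)) k (prefix-irrefl k)) pivots′ , ≐-trans (≐-sym H'≐L) H'≐

  embed : Fin m → Fin N
  embed x = encode (old x)

  embed-injective : Injective _≡_ _≡_ embed
  embed-injective e = old-injective (encode-injective e)
    where
    old-injective : ∀ {x y} → old x ≡ old y → x ≡ y
    old-injective refl = refl

  restrict-H : ∀ S → restrict (H S) embed ≐ mkGraph (λ x y → adj B x y xor sumF (λ k → S k ∧ toggle k x y)) (side B)
  restrict-H S = (λ x y → cong₂ (adjᵛ S) (decode-encode (old x)) (decode-encode (old y))) ,
                 (λ x → cong (sideᵛ S) (decode-encode (old x)))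

  toggled-perturbation : ∀ {G₁} → G₁ ≐ toggled → PivotPerturbation (len + len) G₁ B
  toggled-perturbation G₁≐ with pivot-remaining-pairs len 0 (+-identityʳ len)
  ... | H' , pivots , H'≐ =
    len + len , ≤-refl , H (prefix 0) , H-isBipartite (prefix 0) , embed , embed-injective ,
    (H' , pivots , ≐-trans (restrict-cong H'≐ embed) (≐-trans (restrict-H (λ _ → true)) (≐-sym G₁≐))) ,
    (H (prefix 0) , done , ≐-trans (restrict-H (prefix 0))
      ((λ x y → trans (cong (adj B x y xor_) (sumF-zero (λ k → cong (_∧ toggle k x y) (⌊⌋-no (toℕ k <? 0) λ ()))))
                      (xor-identityʳ (adj B x y))) , λ _ → refl))

-- Counting and splitting basis vertices by side

count : ∀ {r} → (Fin r → Bool) → ℕ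
count {zero}  p = zero
count {suc r} p with p fz
... | true  = suc (count (p ∘ fs))
... | false = count (p ∘ fs)

select : ∀ {r} (p : Fin r → Bool) → Fin (count p) → Fin r
select {suc r} p k with p fz
select {suc r} p fz     | true  = fz
select {suc r} p (fs k) | true  = fs (select (p ∘ fs) k)
select {suc r} p k      | false = fs (select (p ∘ fs) k)

select-selected : ∀ {r} (p : Fin r → Bool) k → p (select p k) ≡ true
select-selected {suc r} p k with p fz in e
select-selected {suc r} p fz     | true  = e
select-selected {suc r} p (fs k) | true  = select-selected (p ∘ fs) k
select-selected {suc r} p k      | false = select-selected (p ∘ fs) k

sumF-select : ∀ {r} (p g : Fin r → Bool) → sumF (λ k → g (select p k)) ≡ p · g
sumF-select {zero}  p g = refl
sumF-select {suc r} p g with p fz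
... | true  = cong (g fz xor_) (sumF-select (p ∘ fs) (g ∘ fs))
... | false = sumF-select (p ∘ fs) (g ∘ fs)

count-complement : ∀ {r} (p q : Fin r → Bool) → (∀ i → q i ≡ not (p i)) → count p + count q ≡ r
count-complement {zero}  p q q≡¬p = refl
count-complement {suc r} p q q≡¬p with p fz | q fz | q≡¬p fz
... | true  | false | _ = cong suc (count-complement (p ∘ fs) (q ∘ fs) (q≡¬p ∘ fs))
... | false | true  | _ = trans (+-suc _ _) (cong suc (count-complement (p ∘ fs) (q ∘ fs) (q≡¬p ∘ fs)))

-- For T symmetric and supported on pairs with different labels, summing (uᵢ·(Tv)ᵢ ⊕ (Tu)ᵢ·vᵢ)
-- over one label class counts every term of uᵀTv exactly once.
split-by-label : ∀ {r} (p : Fin r → Bool) (T : Fin r → Fin r → Bool) →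
  (∀ i j → T i j ≡ T j i) → (∀ i j → T i j ≡ true → p j ≡ not (p i)) → ∀ (u v : Fin r → Bool) →
  p · (λ i → (u i ∧ v · T i) xor (u · T i ∧ v i)) ≡ sumF (λ i → sumF (λ j → (u i ∧ v j) ∧ T i j))
split-by-label {r} p T T-symm T-support u v = begin
  p · (λ i → (u i ∧ v · T i) xor (u · T i ∧ v i))
    ≡⟨ ·-xor p _ _ ⟩
  p · (λ i → u i ∧ v · T i) xor p · (λ i → u · T i ∧ v i)
    ≡⟨ cong₂ _xor_ (·-cong p row-form) column-form ⟩
  p · W xor sumF (λ i → not (p i) ∧ W i)
    ≡⟨ sym (sumF-xor (λ i → p i ∧ W i) (λ i → not (p i) ∧ W i)) ⟩
  sumF (λ i → (p i ∧ W i) xor (not (p i) ∧ W i))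
    ≡⟨ sumF-cong (λ i → split (p i) (W i)) ⟩
  sumF W
    ∎
  where
  W : Fin r → Bool
  W i = sumF (λ j → (u i ∧ v j) ∧ T i j)

  split : ∀ q w → (q ∧ w) xor (not q ∧ w) ≡ w
  split true  w = xor-identityʳ w
  split false w = refl

  row-form : ∀ i → u i ∧ v · T i ≡ W i
  row-form i = trans (∧-distribˡ-sumF (u i) (λ j → v j ∧ T i j)) (sumF-cong (λ j → sym (∧-assoc (u i) (v j) (T i j))))

  column-form : p · (λ i → u · T i ∧ v i) ≡ sumF (λ i → not (p i) ∧ W i)
  column-form = begin
    sumF (λ j → p j ∧ (u · T j ∧ v j))
      ≡⟨ sumF-cong (λ j → cong (p j ∧_) (trans (∧-distribʳ-sumF (v j) (λ i → u i ∧ T j i))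
           (sumF-cong (λ i → rearrange (u i) (v j) (T j i) (T i j) (T-symm j i))))) ⟩
    sumF (λ j → p j ∧ sumF (λ i → (u i ∧ v j) ∧ T i j))
      ≡⟨ sumF-cong (λ j → ∧-distribˡ-sumF (p j) (λ i → (u i ∧ v j) ∧ T i j)) ⟩
    sumF (λ j → sumF (λ i → p j ∧ ((u i ∧ v j) ∧ T i j)))
      ≡⟨ sym (sumF-comm (λ i j → p j ∧ ((u i ∧ v j) ∧ T i j))) ⟩
    sumF (λ i → sumF (λ j → p j ∧ ((u i ∧ v j) ∧ T i j)))
      ≡⟨ sumF-cong (λ i → sumF-cong (λ j → support i j)) ⟩
    sumF (λ i → sumF (λ j → not (p i) ∧ ((u i ∧ v j) ∧ T i j)))
      ≡⟨ sumF-cong (λ i → sym (∧-distribˡ-sumF (not (p i)) (λ j → (u i ∧ v j) ∧ T i j))) ⟩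
    sumF (λ i → not (p i) ∧ W i)
      ∎
    where
    rearrange : ∀ a b t t' → t ≡ t' → (a ∧ t) ∧ b ≡ (a ∧ b) ∧ t'
    rearrange true  b t t' refl = ∧-comm t b
    rearrange false b t t' _    = refl

    support : ∀ i j → p j ∧ ((u i ∧ v j) ∧ T i j) ≡ not (p i) ∧ ((u i ∧ v j) ∧ T i j)
    support i j with T i j in t
    ... | true  = cong (_∧ ((u i ∧ v j) ∧ true)) (T-support i j t)
    ... | false = trans (cong (p j ∧_) (∧-zeroʳ (u i ∧ v j))) (trans (∧-zeroʳ (p j))
                    (sym (trans (cong (not (p i) ∧_) (∧-zeroʳ (u i ∧ v j))) (∧-zeroʳ (not (p i))))))

restrict-isBipartite : ∀ {n m} {G : Graph n} → IsBipartite G → (e : Fin m → Fin n) → IsBipartite (restrict G e)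
restrict-isBipartite BG e = record
  { symm = λ x y → symm (e x) (e y) ; irrefl = λ x → irrefl (e x) ; crosses = λ x y → crosses (e x) (e y) }
  where open IsBipartite BG

PivotPerturbation-mono : ∀ {m t t'} {G₁ G₂ : Graph m} → t ≤ t' → PivotPerturbation t G₁ G₂ → PivotPerturbation t' G₁ G₂
PivotPerturbation-mono t≤t' (k , k≤t , rest) = k , ≤-trans k≤t t≤t' , rest

module CutRankPerturbation {n m : ℕ} {G G' : Graph n} (BG : IsBipartite G)
    (X : Fin n → Bool) (ι : Fin m → Fin n) (ι∈X : ∀ x → X (ι x) ≡ true)
    (pivots : Pivots (λ v → X v ≡ false) G G') {r : ℕ} (cut-rank : CutRank G X ι r) where

  open IsBipartite BG
  open BipartiteProperties BG
  open RowBasis (λ x y → adj G (ι x) y ∧ not (X y)) cut-rank using (basis; row-combination)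

  s : Fin r → Bool
  s i = side G (ι (basis i))

  -- The coefficients of row x, restricted to the basis rows on the side of x.
  c : Fin m → Fin r → Bool
  c x i = proj₁ (row-combination x) i ∧ not (side G (ι x) xor s i)

  not-xor-true : ∀ {a b} → not (a xor b) ≡ true → a ≡ b
  not-xor-true {true}  {true}  _ = refl
  not-xor-true {false} {false} _ = refl

  c-side : ∀ x i → c x i ≡ true → side G (ι x) ≡ s i
  c-side x i h = not-xor-true (proj₂ (∧-true⇒× h))

  rows-combine₀ : ∀ x y → X y ≡ false → adj G (ι x) y ≡ c x · (λ i → adj G (ι (basis i)) y)
  rows-combine₀ x y Xy with side G y ≟ᵇ side G (ι x)
  ... | yes y∼x = trans (same-side⇒¬adj (sym y∼x)) (sym (sumF-zero λ i →
          ∧-false λ cxi → same-side⇒¬adj (trans (sym (c-side x i cxi)) (sym y∼x))))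
  ... | no y≁x = begin
    adj G (ι x) y                                         ≡⟨ sym (cut-entry x) ⟩
    adj G (ι x) y ∧ not (X y)                             ≡⟨ proj₂ (row-combination x) y ⟩
    c₀ · (λ i → adj G (ι (basis i)) y ∧ not (X y))        ≡⟨ ·-cong c₀ (λ i → cut-entry (basis i)) ⟩
    c₀ · (λ i → adj G (ι (basis i)) y)                    ≡⟨ sumF-cong same-side-terms ⟩
    c x · (λ i → adj G (ι (basis i)) y)                   ∎
    where
    c₀ : Fin r → Bool
    c₀ = proj₁ (row-combination x)
    cut-entry : ∀ z → adj G (ι z) y ∧ not (X y) ≡ adj G (ι z) y
    cut-entry z = trans (cong (λ t → adj G (ι z) y ∧ not t) Xy) (∧-identityʳ _)
    -- a basis row meeting y lies on the side opposite to y, which is the side of x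
    same-side-terms : ∀ i → c₀ i ∧ adj G (ι (basis i)) y ≡ c x i ∧ adj G (ι (basis i)) y
    same-side-terms i with adj G (ι (basis i)) y in e
    ... | false = trans (∧-zeroʳ (c₀ i)) (sym (∧-zeroʳ (c x i)))
    ... | true  = trans (∧-identityʳ (c₀ i)) (sym (trans (∧-identityʳ _) (trans (cong (c₀ i ∧_) agree) (∧-identityʳ (c₀ i)))))
      where
      agree : not (side G (ι x) xor s i) ≡ true
      agree = trans (cong (λ t → not (t xor s i)) (trans (¬-not (λ x∼y → y≁x (sym x∼y))) (sym (adj⇒side≡not e))))
                    (cong not (xor-same (s i)))

  open PivotsAvoiding G X ι ι∈X basis c

  invariant-G : Invariant G
  invariant-G = record
    { bipartite    = BG
    ; sides        = λ _ → refl
    ; rows-combine = rows-combine₀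
    ; change       = λ x x' → trans (xor-same (adj G (ι x) (ι x'))) (sym (sumF-zero λ i → sumF-zero λ j →
                       trans (cong ((c x i ∧ c x' j) ∧_) (xor-same (adj G (ι (basis i)) (ι (basis j))))) (∧-zeroʳ _)))
    }

  open Invariant (invariant-Pivots invariant-G pivots) renaming (bipartite to BG')

  D : Fin r → Fin r → Bool
  D = difference G'

  D-symm : ∀ i j → D i j ≡ D j i
  D-symm i j = cong₂ _xor_ (IsBipartite.symm BG' (ι (basis i)) (ι (basis j))) (symm (ι (basis i)) (ι (basis j)))

  D-support : ∀ i j → D i j ≡ true → s j ≡ not (s i)
  D-support i j h = ¬-not λ sj≡si → true≢false (trans (sym h) (cong₂ _xor_
    (BipartiteProperties.same-side⇒¬adj BG' (trans (sides (basis i)) (trans (sym sj≡si) (sym (sides (basis j))))))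
    (same-side⇒¬adj (sym sj≡si))))

  onSide : Bool → Fin r → Bool
  onSide β i = not (s i xor β)

  module UsingSide (β : Bool) where
    private
      p : Fin r → Bool
      p = onSide β

      p-support : ∀ i j → D i j ≡ true → p j ≡ not (p i)
      p-support i j h = trans (cong (λ t → not (t xor β)) (D-support i j h)) (cong not (sym (not-distribˡ-xor (s i) β)))

      P-side : ∀ k x → c x (select p k) ≡ true → side G (ι x) ≡ β
      P-side k x h = trans (c-side x (select p k) h) (not-xor-true (select-selected p k))

      Q-side : ∀ k x → c x · D (select p k) ≡ true → side G (ι x) ≡ not β
      Q-side k x h with sumF-true⇒∃ (λ j → c x j ∧ D (select p k) j) h
      ... | j , e = trans (c-side x j (proj₁ (∧-true⇒× e)))
                   (trans (D-support (select p k) j (proj₂ (∧-true⇒× e))) (cong not (not-xor-true (select-selected p k))))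

    open Gadget (restrict-isBipartite BG ι) β (λ k x → c x (select p k)) (λ k x → c x · D (select p k)) P-side Q-side
      using (toggle; toggled; toggled-perturbation)

    G'-toggled : restrict G' ι ≐ toggled
    G'-toggled = (λ x y → begin
      adj G' (ι x) (ι y)                                  ≡⟨ xor-solveˡ (change x y) ⟩
      adj G (ι x) (ι y) xor bilinear D x y                ≡⟨ cong (adj G (ι x) (ι y) xor_) (sym (trans
                                                              (sumF-select p _) (split-by-label p D D-symm p-support (c x) (c y)))) ⟩
      adj G (ι x) (ι y) xor sumF (λ k → toggle k x y)     ∎) ,
      sides

    perturbation : PivotPerturbation (count p + count p) (restrict G' ι) (restrict G ι)
    perturbation = toggled-perturbation G'-toggled

  sides-partition : count (onSide true) + count (onSide false) ≡ r
  sides-partition = count-complement (onSide true) (onSide false) λ i → complement (s i)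
    where
    complement : ∀ t → not (t xor false) ≡ not (not (t xor true))
    complement true  = refl
    complement false = refl

  perturbation : PivotPerturbation r (restrict G' ι) (restrict G ι)
  perturbation with count (onSide true) ≤? count (onSide false)
  ... | yes t≤f = PivotPerturbation-mono (≤-trans (+-monoʳ-≤ (count (onSide true)) t≤f) (≤-reflexive sides-partition))
                    (UsingSide.perturbation true)
  ... | no t≰f  = PivotPerturbation-mono (≤-trans (+-monoʳ-≤ (count (onSide false)) (<⇒≤ (≰⇒> t≰f)))
                    (≤-reflexive (trans (+-comm (count (onSide false)) _) sides-partition)))
                    (UsingSide.perturbation false)

lemma9p4 : ∀ {n m : ℕ} (G G' : Graph n) → IsBipartite G →
    (X : Fin n → Bool) → (ι : Fin m → Fin n) → Injective _≡_ _≡_ ι →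
    (∀ i → X (ι i) ≡ true) → (∀ y → X y ≡ true → ∃ λ i → ι i ≡ y) →
    Pivots (λ v → X v ≡ false) G G' →
    (r : ℕ) → CutRank G X ι r →
    PivotPerturbation r (restrict G' ι) (restrict G ι)
lemma9p4 G G' BG X ι _ ι∈X _ pivots r cut-rank = CutRankPerturbation.perturbation BG X ι ι∈X pivots cut-rank
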